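{- Let $\sigma$ be a one-stack sortable permutation. Then every permutation obtained from $\sigma$ by a single deletion, and every permutation obtained from $\sigma$ by a single insertion (of any of the types $(\Lambda\to\varnothing)$, $(\Lambda\to f)$, $(\Lambda \overset{r}{\to} f)$, $(\Lambda \overset{l}{\to} f)$), is again a one-stack sortable permutation.
   Context: Permutations are written as words. One-stack sortable permutations are defined recursively: the empty word is one-stack sortable, and a permutation $\sigma$ of $\{1,\dots,n\}$ with $n\ge 1$ is one-stack sortable if $\sigma = I\,n\,J$ for some $0\le p\le n-1$, where $I$ is a one-stack sortable permutation of $\{1,\dots,p\}$ and $J$ is a word on $\{p+1,\dots,n-1\}$ which becomes a one-stack sortable permutation after subtracting $p$ from each letter ($I$ or $J$ may be empty). A factor of $\sigma=\sigma_1\cdots\sigma_n$ is a word $\sigma_k\sigma_{k+1}\cdots\sigma_{k+l}$ of consecutive letters. A factor is compact if its set of letters is an interval of integers. A factor $f$ of $\sigma$ is complete if it is compact and there is no nonempty factor $g$ of $\sigma$ such that the concatenation $fg$ is a factor of $\sigma$ that is compact and whose largest letter equals the largest letter of $f$. For a word $w=w_1\cdots w_k$ and an integer $a$, $\overline{w}^{a}$ denotes the word $w'_1\cdots w'_k$ with $w'_i=w_i$ if $w_i<a$ and $w'_i=w_i+1$ otherwise. Deletion $(\sigma_k\to\Lambda)$: remove the letter $\sigma_k$ from $\sigma$ and renormalize (decrease by $1$ every letter greater than $\sigma_k$), giving a permutation of $\{1,\dots,n-1\}$. Insertion: $(\Lambda\to\varnothing)$ transforms the empty permutation into $(1)$.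 If $\sigma$ is nonempty, let $f$ be a complete factor of $\sigma$ and write $\sigma = u f v$. Then $(\Lambda\to f)$ produces $\overline{u}^{a}\,a\,f\,\overline{v}^{a}$ with $a=\max f+1$; $(\Lambda \overset{r}{\to} f)$ produces $\overline{u}^{a}\,f\,a\,\overline{v}^{a}$ with $a=\max f+1$; $(\Lambda \overset{l}{\to} f)$ produces $\overline{u}^{a}\,a\,\overline{f}^{a}\,\overline{v}^{a}$ with $a=\min f$. -}

module Defs where

open import Data.Nat using (ℕ; zero; suc; _∸_; _≤_; _<_; _<ᵇ_; _⊔_; _⊓_)
open import Data.Bool using (if_then_else_)
open import Data.List using (List; []; _∷_; _++_; map; foldr; length; lookup; removeAt)
open import Data.List.Relation.Unary.All using (All)
open import Data.List.Membership.Propositional using (_∈_)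
open import Data.Fin using (Fin)
open import Data.Product using (Σ; _×_; ∃)
open import Relation.Binary.PropositionalEquality using (_≡_; _≢_)
open import Relation.Nullary using (¬_)

-- OSS n w : w is a one-stack sortable permutation of {1,…,n},
-- following the recursive definition: w = I (m+1) J with I a one-stack
-- sortable permutation of {1..p}, J a word on {p+1..m} which after
-- subtracting p is a one-stack sortable permutation (of {1..m-p}).
data OSS : ℕ → List ℕ → Set where
  oss-empty : OSS zero []
  oss-split : ∀ {m p I J} →
    p ≤ m →
    OSS p I →
    All (λ x → p < x × x ≤ m) J →
    OSS (m ∸ p) (map (λ x → x ∸ p) J) →
    OSS (suc m) (I ++ suc m ∷ J)

OneStackSortable : List ℕ → Set
OneStackSortable σ = Σ ℕ λ n → OSS n σ

maxL : List ℕ → ℕ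
maxL = foldr _⊔_ 0

minL : List ℕ → ℕ
minL []       = 0
minL (x ∷ xs) = foldr _⊓_ x xs

Factor : List ℕ → List ℕ → Set
Factor w σ = Σ (List ℕ) λ u → Σ (List ℕ) λ v → σ ≡ u ++ w ++ v

Compact : List ℕ → Set
Compact w = Σ ℕ λ a → Σ ℕ λ b →
  (∀ x → x ∈ w → a ≤ x × x ≤ b) × (∀ x → a ≤ x → x ≤ b → x ∈ w)

Complete : List ℕ → List ℕ → Set
Complete σ f =
  f ≢ [] × Factor f σ × Compact f ×
  ¬ (Σ (List ℕ) λ g → g ≢ [] × Factor (f ++ g) σ × Compact (f ++ g) × maxL (f ++ g) ≡ maxL f)

bump : ℕ → List ℕ → List ℕ
bump a = map (λ x → if x <ᵇ a then x else suc x)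

delete : (σ : List ℕ) → Fin (length σ) → List ℕ
delete σ k = map (λ x → if lookup σ k <ᵇ x then x ∸ 1 else x) (removeAt σ k)

insΛ→f : List ℕ → List ℕ → List ℕ → List ℕ
insΛ→f u f v = let a = suc (maxL f) in bump a u ++ a ∷ f ++ bump a v

insΛ→ʳf : List ℕ → List ℕ → List ℕ → List ℕ
insΛ→ʳf u f v = let a = suc (maxL f) in bump a u ++ f ++ a ∷ bump a v

insΛ→ˡf : List ℕ → List ℕ → List ℕ → List ℕ
insΛ→ˡf u f v = let a = minL f in bump a u ++ a ∷ bump a f ++ bump a v

-- One-stack sortable permutations are exactly the permutations avoiding 231: in
-- I n J, a 231 through the maximum n is a letter of I above a letter of J, and
-- the recursive splitting exists precisely when there is none.  Deleting a letter
-- keeps 231-avoidance because renormalising is monotone.  For an insertion at a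
-- complete factor f of σ = u f v, with minimum c and maximum d, two facts suffice:
-- every letter of v exceeds d (otherwise the maximal run of letters below c at
-- the start of v would extend f to a longer compact factor with the same
-- maximum), and u has no ascent x < y with c ≤ x (such an x lies outside f, so
-- above d, and x y d would be a 231).  These rule out every 231 through the new
-- letter in each of the three insertions.

{-# OPTIONS --safe #-}
module Submission where

open import Defs
open import Data.Nat
  using (ℕ; zero; suc; s≤s⁻¹; _+_; _∸_; _≤_; _<_; _<ᵇ_; _⊓_; z≤n; s≤s; _≤?_; _<?_; _≟_)
open import Data.Nat.Properties
open import Data.Bool using (true; false; if_then_else_)
open import Data.List as List using (List; []; _∷_; _++_; map; foldr; length; removeAt; dropWhile; takeWhile)
open import Data.Fin using (Fin; zero; suc)
open import Data.List.Properties using (map-++; ++-assoc; map-∘; map-id-local; takeWhile++dropWhile)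
open import Data.List.Membership.Propositional using (_∈_; _∉_)
open import Data.List.Membership.Propositional.Properties
  using (∈-++⁺ˡ; ∈-++⁺ʳ; ∈-++⁻; ∈-map⁺; ∈-map⁻; ∈-insert; ∈-∃++)
open import Data.List.Relation.Unary.Any using (here; there)
open import Data.List.Relation.Unary.All as All using (All)
import Data.List.Relation.Unary.All.Properties as All
open import Data.List.Relation.Unary.Unique.Propositional using (Unique; []; _∷_; head)
import Data.List.Relation.Unary.Unique.Propositional.Properties as Unique
open import Data.List.Relation.Binary.Pointwise using (Pointwise; []; _∷_)
open import Data.List.Relation.Binary.Sublist.Propositional
  using (_⊆_; []; _∷_; _∷ʳ_; ⊆-refl; ⊆-trans; lookup; to∈; from∈)
import Data.List.Relation.Binary.Sublist.Propositional.Properties as Sublist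
open import Function using (_∘_; id)
open import Data.Product using (∃; ∃₂; _×_; _,_; proj₁; proj₂; uncurry)
open import Data.Sum as Sum using (_⊎_; inj₁; inj₂; [_,_]′)
open import Data.Empty using (⊥; ⊥-elim)
open import Relation.Nullary using (¬_; yes; no; ofʸ; ofⁿ; contradiction)
open import Relation.Binary.Core using (_Preserves_⟶_)
open import Relation.Binary.PropositionalEquality
open import Data.Maybe.Relation.Unary.All using (just)
open import Data.Nat.Induction using (<-rec)

⊆-++⁻ : ∀ A {B p : List ℕ} → p ⊆ A ++ B → ∃₂ λ p₁ p₂ → p ≡ p₁ ++ p₂ × p₁ ⊆ A × p₂ ⊆ B
⊆-++⁻ []      p⊆B = [] , _ , refl , [] , p⊆B
⊆-++⁻ (a ∷ A) (_ ∷ʳ p⊆) with ⊆-++⁻ A p⊆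
... | p₁ , p₂ , refl , p₁⊆ , p₂⊆ = p₁ , p₂ , refl , a ∷ʳ p₁⊆ , p₂⊆
⊆-++⁻ (a ∷ A) (refl ∷ p⊆) with ⊆-++⁻ A p⊆
... | p₁ , p₂ , refl , p₁⊆ , p₂⊆ = a ∷ p₁ , p₂ , refl , refl ∷ p₁⊆ , p₂⊆

⊆-middle⁻ : ∀ A {a} {B p : List ℕ} → p ⊆ A ++ a ∷ B →
  p ⊆ A ++ B ⊎ ∃₂ λ p₁ p₂ → p ≡ p₁ ++ a ∷ p₂ × p₁ ⊆ A × p₂ ⊆ B
⊆-middle⁻ A p⊆ with ⊆-++⁻ A p⊆
... | p₁ , p₂ , refl , p₁⊆ , _ ∷ʳ p₂⊆   = inj₁ (Sublist.++⁺ p₁⊆ p₂⊆)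
... | p₁ , p₂ , refl , p₁⊆ , refl ∷ p₂⊆ = inj₂ (p₁ , _ , refl , p₁⊆ , p₂⊆)

⊆-skip-middle : ∀ A {s} {B : List ℕ} → A ++ B ⊆ A ++ s ∷ B
⊆-skip-middle A {s} = Sublist.++⁺ (⊆-refl {x = A}) (s ∷ʳ ⊆-refl)

∈-middle⁺ : ∀ A {s} {B : List ℕ} {x} → x ∈ A ++ B → x ∈ A ++ s ∷ B
∈-middle⁺ A = lookup (⊆-skip-middle A)

∈-middle⁻ : ∀ A {s} {B : List ℕ} {x} → x ∈ A ++ s ∷ B → x ≡ s ⊎ x ∈ A ++ B
∈-middle⁻ A x∈ with ∈-++⁻ A x∈
... | inj₁ x∈A         = inj₂ (∈-++⁺ˡ x∈A)
... | inj₂ (here x≡s)  = inj₁ x≡s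
... | inj₂ (there x∈B) = inj₂ (∈-++⁺ʳ A x∈B)

pair-⊆-++⁻ : ∀ A {B : List ℕ} {x y} → x ∷ y ∷ [] ⊆ A ++ B → x ∷ y ∷ [] ⊆ A ⊎ y ∈ B
pair-⊆-++⁻ []      p          = inj₂ (lookup p (there (here refl)))
pair-⊆-++⁻ (a ∷ A) (_ ∷ʳ p)   = Sum.map₁ (a ∷ʳ_) (pair-⊆-++⁻ A p)
pair-⊆-++⁻ (a ∷ A) (refl ∷ p) = Sum.map₁ (λ y∈A → refl ∷ from∈ y∈A) (∈-++⁻ A (to∈ p))

⊆-map⁻ : ∀ (g : ℕ → ℕ) w {p} → p ⊆ map g w → ∃ λ q → q ⊆ w × Pointwise (λ x x₀ → x ≡ g x₀) p q
⊆-map⁻ g []      []          = [] , [] , []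
⊆-map⁻ g (x ∷ w) (_ ∷ʳ p⊆) with ⊆-map⁻ g w p⊆
... | q , q⊆ , p≗q = q , x ∷ʳ q⊆ , p≗q
⊆-map⁻ g (x ∷ w) (refl ∷ p⊆) with ⊆-map⁻ g w p⊆
... | q , q⊆ , p≗q = x ∷ q , refl ∷ q⊆ , refl ∷ p≗q

unique-⊆ : ∀ {xs ys : List ℕ} → xs ⊆ ys → Unique ys → Unique xs
unique-⊆ []          []         = []
unique-⊆ (_ ∷ʳ xs⊆)  (_ ∷ u)    = unique-⊆ xs⊆ u
unique-⊆ (refl ∷ xs⊆) (x∉ ∷ u)  = All.anti-mono (lookup xs⊆) x∉ ∷ unique-⊆ xs⊆ u

unique-++-disjoint : ∀ A {B : List ℕ} {x} → Unique (A ++ B) → x ∈ A → x ∈ B → ⊥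
unique-++-disjoint (a ∷ A) (a∉ ∷ _) (here refl)  x∈B = All.lookup a∉ (∈-++⁺ʳ A x∈B) refl
unique-++-disjoint (a ∷ A) (_ ∷ u)  (there x∈A) x∈B = unique-++-disjoint A u x∈A x∈B

unique-middle⁻ : ∀ A {s B} → Unique (A ++ s ∷ B) → s ∉ A ++ B
unique-middle⁻ A {s} {B} u s∈ with ∈-++⁻ A s∈
... | inj₁ s∈A = unique-++-disjoint A u s∈A (here refl)
... | inj₂ s∈B = All.lookup (head (unique-⊆ (Sublist.++⁺ˡ A ⊆-refl) u)) s∈B refl

unique-middle⁺ : ∀ A {s B} → s ∉ A ++ B → Unique (A ++ B) → Unique (A ++ s ∷ B)
unique-middle⁺ A {s} {B} s∉ u =
  Unique.++⁺ (unique-⊆ (Sublist.++⁺ʳ B ⊆-refl) u)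
             (All.¬Any⇒All¬ B (s∉ ∘ ∈-++⁺ʳ A) ∷ unique-⊆ (Sublist.++⁺ˡ A ⊆-refl) u)
             disjoint
  where
  disjoint : ∀ {x} → ¬ (x ∈ A × x ∈ s ∷ B)
  disjoint (x∈A , here refl) = s∉ (∈-++⁺ˡ x∈A)
  disjoint (x∈A , there x∈B) = unique-++-disjoint A u x∈A x∈B

unique-map⁺ : ∀ {g : ℕ → ℕ} {w} → (∀ {x y} → x ∈ w → y ∈ w → g x ≡ g y → x ≡ y) →
  Unique w → Unique (map g w)
unique-map⁺ {w = []}    _   []        = []
unique-map⁺ {w = x ∷ w} inj (x∉ ∷ u) =
  All.map⁺ (All.tabulate λ y∈w gx≡gy → All.lookup x∉ y∈w (inj (here refl) (there y∈w) gx≡gy))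
  ∷ unique-map⁺ (λ x∈w y∈w → inj (there x∈w) (there y∈w)) u

∈⇒≤maxL : ∀ w {x} → x ∈ w → x ≤ maxL w
∈⇒≤maxL (y ∷ w) (here refl) = m≤m⊔n y (maxL w)
∈⇒≤maxL (y ∷ w) (there x∈w) = m≤n⇒m≤o⊔n y (∈⇒≤maxL w x∈w)

maxL-lub : ∀ w {b} → (∀ {x} → x ∈ w → x ≤ b) → maxL w ≤ b
maxL-lub []      _   = z≤n
maxL-lub (y ∷ w) w≤b = ⊔-lub (w≤b (here refl)) (maxL-lub w (w≤b ∘ there))

maxL-< : ∀ w {b} → 0 < b → (∀ {x} → x ∈ w → x < b) → maxL w < b
maxL-< []      0<b _   = 0<b
maxL-< (y ∷ w) 0<b w<b = ⊔-pres-<m (w<b (here refl)) (maxL-< w 0<b (w<b ∘ there))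

maxL-∈ : ∀ w → w ≢ [] → maxL w ∈ w
maxL-∈ []          w≢[] = contradiction refl w≢[]
maxL-∈ (y ∷ [])    _    = here (⊔-identityʳ y)
maxL-∈ (y ∷ z ∷ w) _    with ⊔-sel y (maxL (z ∷ w)) | maxL-∈ (z ∷ w) (λ ())
... | inj₁ max≡y | _     = here max≡y
... | inj₂ max≡w | max∈w = there (subst (_∈ z ∷ w) (sym max≡w) max∈w)

foldr⊓-≤ : ∀ x xs {y} → y ∈ x ∷ xs → foldr _⊓_ x xs ≤ y
foldr⊓-≤ x []       (here refl)          = ≤-refl
foldr⊓-≤ x (z ∷ zs) (there (here refl))  = m⊓n≤m z _
foldr⊓-≤ x (z ∷ zs) (here refl)          = m≤n⇒o⊓m≤n z (foldr⊓-≤ x zs (here refl))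
foldr⊓-≤ x (z ∷ zs) (there (there y∈zs)) = m≤n⇒o⊓m≤n z (foldr⊓-≤ x zs (there y∈zs))

foldr⊓-∈ : ∀ x xs → foldr _⊓_ x xs ∈ x ∷ xs
foldr⊓-∈ x []       = here refl
foldr⊓-∈ x (z ∷ zs) with ⊓-sel z (foldr _⊓_ x zs) | foldr⊓-∈ x zs
... | inj₁ min≡z  | _            = there (here min≡z)
... | inj₂ min≡zs | here eq      = here (trans min≡zs eq)
... | inj₂ min≡zs | there m∈zs   = there (there (subst (_∈ zs) (sym min≡zs) m∈zs))

minL-≤ : ∀ w {y} → y ∈ w → minL w ≤ y
minL-≤ (x ∷ xs) = foldr⊓-≤ x xs

minL-∈ : ∀ w → w ≢ [] → minL w ∈ w
minL-∈ []       w≢[] = contradiction refl w≢[]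
minL-∈ (x ∷ xs) _    = foldr⊓-∈ x xs

-- bump a = map (bumpLetter a) and delete σ k = map (unbumpLetter (lookup σ k)) (removeAt σ k)
-- hold definitionally.
bumpLetter : ℕ → ℕ → ℕ
bumpLetter a x = if x <ᵇ a then x else suc x

unbumpLetter : ℕ → ℕ → ℕ
unbumpLetter s x = if s <ᵇ x then x ∸ 1 else x

bumpLetter-< : ∀ {a x} → x < a → bumpLetter a x ≡ x
bumpLetter-< {a} {x} x<a with x <ᵇ a | <ᵇ-reflects-< x a
... | true  | _       = refl
... | false | ofⁿ x≮a = contradiction x<a x≮a

bumpLetter-≥ : ∀ {a x} → a ≤ x → bumpLetter a x ≡ suc x
bumpLetter-≥ {a} {x} a≤x with x <ᵇ a | <ᵇ-reflects-< x a
... | true  | ofʸ x<a = contradiction a≤x (<⇒≱ x<a)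
... | false | _       = refl

unbumpLetter-≤ : ∀ {s x} → x ≤ s → unbumpLetter s x ≡ x
unbumpLetter-≤ {s} {x} x≤s with s <ᵇ x | <ᵇ-reflects-< s x
... | true  | ofʸ s<x = contradiction x≤s (<⇒≱ s<x)
... | false | _       = refl

unbumpLetter-> : ∀ {s x} → s < x → unbumpLetter s x ≡ x ∸ 1
unbumpLetter-> {s} {x} s<x with s <ᵇ x | <ᵇ-reflects-< s x
... | true  | _       = refl
... | false | ofⁿ s≮x = contradiction s<x s≮x

bumpLetter-mono : ∀ a → bumpLetter a Preserves _≤_ ⟶ _≤_
bumpLetter-mono a {x} {y} x≤y with x <ᵇ a | <ᵇ-reflects-< x a | y <ᵇ a | <ᵇ-reflects-< y a
... | true  | _       | true  | _       = x≤y
... | true  | _       | false | _       = m≤n⇒m≤1+n x≤y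
... | false | ofⁿ x≮a | true  | ofʸ y<a = contradiction (≤-<-trans x≤y y<a) x≮a
... | false | _       | false | _       = s≤s x≤y

unbumpLetter-mono : ∀ s → unbumpLetter s Preserves _≤_ ⟶ _≤_
unbumpLetter-mono s {x} {y} x≤y with s <ᵇ x | <ᵇ-reflects-< s x | s <ᵇ y | <ᵇ-reflects-< s y
... | true  | _       | true  | _       = ∸-monoˡ-≤ 1 x≤y
... | true  | ofʸ s<x | false | ofⁿ s≮y = contradiction (<-≤-trans s<x x≤y) s≮y
... | false | ofⁿ s≮x | true  | ofʸ s<y = ≤-trans (≮⇒≥ s≮x) (suc[m]≤n⇒m≤pred[n] s<y)
... | false | _       | false | _       = x≤y

unbump-bump : ∀ a x → unbumpLetter a (bumpLetter a x) ≡ x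
unbump-bump a x with x <? a
... | yes x<a rewrite bumpLetter-< x<a = unbumpLetter-≤ (<⇒≤ x<a)
... | no  x≮a rewrite bumpLetter-≥ (≮⇒≥ x≮a) = unbumpLetter-> (s≤s (≮⇒≥ x≮a))

bump-unbump : ∀ {a x} → x ≢ a → bumpLetter a (unbumpLetter a x) ≡ x
bump-unbump {a} {x} x≢a with a <? x
bump-unbump {a} {suc x} _ | yes a<x rewrite unbumpLetter-> a<x = bumpLetter-≥ (s≤s⁻¹ a<x)
... | no a≮x rewrite unbumpLetter-≤ (≮⇒≥ a≮x) = bumpLetter-< (≤∧≢⇒< (≮⇒≥ a≮x) x≢a)

bumpLetter-injective : ∀ a {x y} → bumpLetter a x ≡ bumpLetter a y → x ≡ y
bumpLetter-injective a {x} {y} eq = begin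
  x                               ≡⟨ unbump-bump a x ⟨
  unbumpLetter a (bumpLetter a x) ≡⟨ cong (unbumpLetter a) eq ⟩
  unbumpLetter a (bumpLetter a y) ≡⟨ unbump-bump a y ⟩
  y                               ∎
  where open ≡-Reasoning

bumpLetter-≢ : ∀ a x → bumpLetter a x ≢ a
bumpLetter-≢ a x with x <? a
... | yes x<a rewrite bumpLetter-< x<a = <⇒≢ x<a
... | no  x≮a rewrite bumpLetter-≥ (≮⇒≥ x≮a) = λ x+1≡a → x≮a (subst (x <_) x+1≡a ≤-refl)

≤-bumpLetter : ∀ a x → x ≤ bumpLetter a x
≤-bumpLetter a x with x <? a
... | yes x<a rewrite bumpLetter-< x<a = ≤-refl
... | no  x≮a rewrite bumpLetter-≥ (≮⇒≥ x≮a) = n≤1+n x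

bumpLetter-≤ : ∀ a x → bumpLetter a x ≤ suc x
bumpLetter-≤ a x with x <? a
... | yes x<a rewrite bumpLetter-< x<a = n≤1+n x
... | no  x≮a rewrite bumpLetter-≥ (≮⇒≥ x≮a) = ≤-refl

bumpLetter-<⁻ : ∀ a {x} → bumpLetter a x < a → x < a
bumpLetter-<⁻ a {x} = ≤-<-trans (≤-bumpLetter a x)

bumpLetter->⁻ : ∀ a {x} → a < bumpLetter a x → a ≤ x
bumpLetter->⁻ a {x} a<bx with x <? a
... | yes x<a rewrite bumpLetter-< x<a = contradiction a<bx (<-asym x<a)
... | no  x≮a = ≮⇒≥ x≮a

unbumpLetter-bounds : ∀ {s x m} → 0 < s × s ≤ suc m → 0 < x × x ≤ suc m → x ≢ s →
  0 < unbumpLetter s x × unbumpLetter s x ≤ m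
unbumpLetter-bounds {s} {x} _ _ _ with s <? x
unbumpLetter-bounds {s} {suc x} (0<s , _) (_ , x<2+m) _ | yes s<x rewrite unbumpLetter-> s<x =
  ≤-trans 0<s (s≤s⁻¹ s<x) , s≤s⁻¹ x<2+m
unbumpLetter-bounds (_ , s≤1+m) (0<x , _) x≢s | no s≮x rewrite unbumpLetter-≤ (≮⇒≥ s≮x) =
  0<x , s≤s⁻¹ (<-≤-trans (≤∧≢⇒< (≮⇒≥ s≮x) x≢s) s≤1+m)

bump-id : ∀ {a w} → (∀ {x} → x ∈ w → x < a) → bump a w ≡ w
bump-id w<a = map-id-local (All.tabulate (bumpLetter-< ∘ w<a))

insertLetter : ℕ → List ℕ → List ℕ → List ℕ
insertLetter a A B = bump a A ++ a ∷ bump a B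

-- 231-avoidance

Avoids231 : List ℕ → Set
Avoids231 w = ∀ {x y z} → x ∷ y ∷ z ∷ [] ⊆ w → z < x → x < y → ⊥

avoids231-⊆ : ∀ {v w} → v ⊆ w → Avoids231 w → Avoids231 v
avoids231-⊆ v⊆w av p = av (⊆-trans p v⊆w)

mono-reflects-< : ∀ {g} → g Preserves _≤_ ⟶ _≤_ → ∀ {x y} → g x < g y → x < y
mono-reflects-< mono {x} {y} gx<gy with x <? y
... | yes x<y = x<y
... | no  x≮y = contradiction (mono (≮⇒≥ x≮y)) (<⇒≱ gx<gy)

avoids231-map : ∀ {g} → g Preserves _≤_ ⟶ _≤_ → ∀ {w} → Avoids231 w → Avoids231 (map g w)
avoids231-map {g} mono {w} av p z<x x<y with ⊆-map⁻ g w p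
... | _ , p₀ , refl ∷ refl ∷ refl ∷ [] = av p₀ (mono-reflects-< mono z<x) (mono-reflects-< mono x<y)

avoids231-++ : ∀ {A B} → Avoids231 A → Avoids231 B → (∀ {x z} → x ∈ A → z ∈ B → x < z) →
  Avoids231 (A ++ B)
avoids231-++ {A} avA avB A<B p z<x x<y with ⊆-++⁻ A p
... | []              , _      , refl , _  , p₂ = avB p₂ z<x x<y
... | _ ∷ []          , _      , refl , p₁ , p₂ = <-asym z<x (A<B (to∈ p₁) (lookup p₂ (there (here refl))))
... | _ ∷ _ ∷ []      , _      , refl , p₁ , p₂ = <-asym z<x (A<B (to∈ p₁) (to∈ p₂))
... | _ ∷ _ ∷ _ ∷ []  , []     , refl , p₁ , _  = avA p₁ z<x x<y
... | _ ∷ _ ∷ _ ∷ []  , _ ∷ _  , ()   , _  , _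
... | _ ∷ _ ∷ _ ∷ _ ∷ _ , _    , ()   , _  , _

-- Conditions on the letters of A ++ B, before bumping, under which the inserted
-- letter a is neither the 2, nor the 3, nor the 1 of a 231 pattern.
record SafeInsertion (a : ℕ) (A B : List ℕ) : Set where
  field
    not-first  : ∀ {y z} → y ∷ z ∷ [] ⊆ B → z < a → a ≤ y → ⊥
    not-middle : ∀ {x z} → x ∈ A → z ∈ B → z < x → x < a → ⊥
    not-last   : ∀ {x y} → x ∷ y ∷ [] ⊆ A → a ≤ x → x < y → ⊥

avoids231-insertLetter : ∀ {a} A B → Avoids231 (A ++ B) → SafeInsertion a A B →
  Avoids231 (insertLetter a A B)
avoids231-insertLetter {a} A B av safe p z<x x<y with ⊆-middle⁻ (bump a A) p
... | inj₁ p⊆ =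
  avoids231-map (bumpLetter-mono a) av (subst (_ ⊆_) (sym (map-++ (bumpLetter a) A B)) p⊆) z<x x<y
... | inj₂ ([] , _ , refl , _ , p₂) with ⊆-map⁻ (bumpLetter a) B p₂
...   | _ , p₀ , refl ∷ refl ∷ [] =
  SafeInsertion.not-first safe p₀ (bumpLetter-<⁻ a z<x) (bumpLetter->⁻ a x<y)
avoids231-insertLetter {a} A B av safe p z<x x<y | inj₂ (_ ∷ [] , _ ∷ [] , refl , p₁ , p₂)
  with ∈-map⁻ (bumpLetter a) (to∈ p₁) | ∈-map⁻ (bumpLetter a) (to∈ p₂)
... | _ , x∈A , refl | _ , z∈B , refl =
  SafeInsertion.not-middle safe x∈A z∈B (mono-reflects-< (bumpLetter-mono a) z<x) (bumpLetter-<⁻ a x<y)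
avoids231-insertLetter {a} A B av safe p z<x x<y | inj₂ (_ ∷ _ ∷ [] , [] , refl , p₁ , _)
  with ⊆-map⁻ (bumpLetter a) A p₁
... | _ , p₀ , refl ∷ refl ∷ [] =
  SafeInsertion.not-last safe p₀ (bumpLetter->⁻ a z<x) (mono-reflects-< (bumpLetter-mono a) x<y)
avoids231-insertLetter A B av safe p z<x x<y | inj₂ (_ ∷ [] , [] , () , _)
avoids231-insertLetter A B av safe p z<x x<y | inj₂ (_ ∷ [] , _ ∷ _ ∷ _ , () , _)
avoids231-insertLetter A B av safe p z<x x<y | inj₂ (_ ∷ _ ∷ [] , _ ∷ _ , () , _)
avoids231-insertLetter A B av safe p z<x x<y | inj₂ (_ ∷ _ ∷ _ ∷ [] , _ , () , _)
avoids231-insertLetter A B av safe p z<x x<y | inj₂ (_ ∷ _ ∷ _ ∷ _ ∷ _ , _ , () , _)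

-- Permutations of an interval

record IsPermOf (lo hi : ℕ) (w : List ℕ) : Set where
  field
    unique  : Unique w
    bounded : ∀ {x} → x ∈ w → lo < x × x ≤ hi
    covers  : ∀ {x} → lo < x → x ≤ hi → x ∈ w
open IsPermOf

IsPerm : ℕ → List ℕ → Set
IsPerm = IsPermOf 0

isPerm-[] : IsPerm 0 []
isPerm-[] = record { unique = [] ; bounded = λ () ; covers = λ 0<x x≤0 → ⊥-elim (<⇒≱ 0<x x≤0) }

isPermOf-∸ : ∀ {lo hi J} → lo ≤ hi → IsPermOf lo hi J → IsPerm (hi ∸ lo) (map (_∸ lo) J)
isPermOf-∸ {lo} {hi} {J} lo≤hi P = record
  { unique  = unique-map⁺ (λ x∈ y∈ → ∸-cancelʳ-≡ (lo≤ x∈) (lo≤ y∈)) (unique P)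
  ; bounded = bounded′
  ; covers  = covers′
  }
  where
  lo≤ : ∀ {x} → x ∈ J → lo ≤ x
  lo≤ = <⇒≤ ∘ proj₁ ∘ bounded P
  bounded′ : ∀ {y} → y ∈ map (_∸ lo) J → 0 < y × y ≤ hi ∸ lo
  bounded′ y∈ with ∈-map⁻ (_∸ lo) y∈
  ... | x , x∈J , refl = m<n⇒0<n∸m (proj₁ (bounded P x∈J)) , ∸-monoˡ-≤ lo (proj₂ (bounded P x∈J))
  covers′ : ∀ {y} → 0 < y → y ≤ hi ∸ lo → y ∈ map (_∸ lo) J
  covers′ {y} 0<y y≤ =
    subst (_∈ map (_∸ lo) J) (m+n∸n≡m y lo) (∈-map⁺ (_∸ lo) (covers P (m<n+m lo 0<y) y+lo≤hi))
    where
    y+lo≤hi : y + lo ≤ hi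
    y+lo≤hi = subst (y + lo ≤_) (m∸n+n≡m lo≤hi) (+-monoˡ-≤ lo y≤)

isPermOf-∸⁻ : ∀ {lo hi J} → All (λ x → lo < x × x ≤ hi) J → IsPerm (hi ∸ lo) (map (_∸ lo) J) →
  IsPermOf lo hi J
isPermOf-∸⁻ {lo} {hi} {J} J-bounds P = record
  { unique  = Unique.map⁻ (unique P)
  ; bounded = All.lookup J-bounds
  ; covers  = covers′
  }
  where
  covers′ : ∀ {x} → lo < x → x ≤ hi → x ∈ J
  covers′ lo<x x≤hi with ∈-map⁻ (_∸ lo) (covers P (m<n⇒0<n∸m lo<x) (∸-monoˡ-≤ lo x≤hi))
  ... | z , z∈J , x∸lo≡z∸lo =
    subst (_∈ J) (sym (∸-cancelʳ-≡ (<⇒≤ lo<x) (<⇒≤ (proj₁ (All.lookup J-bounds z∈J))) x∸lo≡z∸lo)) z∈J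

isPerm-split⁺ : ∀ {m p I J} → p ≤ m → IsPerm p I → IsPermOf p m J → IsPerm (suc m) (I ++ suc m ∷ J)
isPerm-split⁺ {m} {p} {I} {J} p≤m PI PJ = record
  { unique  = unique-middle⁺ I 1+m∉ (Unique.++⁺ (unique PI) (unique PJ) I∩J≡∅)
  ; bounded = bounded′
  ; covers  = covers′
  }
  where
  I≤p : ∀ {x} → x ∈ I → x ≤ p
  I≤p = proj₂ ∘ bounded PI
  I∩J≡∅ : ∀ {x} → ¬ (x ∈ I × x ∈ J)
  I∩J≡∅ (x∈I , x∈J) = <⇒≱ (proj₁ (bounded PJ x∈J)) (I≤p x∈I)
  1+m∉ : suc m ∉ I ++ J
  1+m∉ 1+m∈ with ∈-++⁻ I 1+m∈
  ... | inj₁ ∈I = 1+n≰n (≤-trans (I≤p ∈I) p≤m)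
  ... | inj₂ ∈J = 1+n≰n (proj₂ (bounded PJ ∈J))
  bounded′ : ∀ {x} → x ∈ I ++ suc m ∷ J → 0 < x × x ≤ suc m
  bounded′ x∈ with ∈-middle⁻ I x∈
  ... | inj₁ refl = s≤s z≤n , ≤-refl
  ... | inj₂ x∈′ with ∈-++⁻ I x∈′
  ...   | inj₁ x∈I = proj₁ (bounded PI x∈I) , m≤n⇒m≤1+n (≤-trans (I≤p x∈I) p≤m)
  ...   | inj₂ x∈J with bounded PJ x∈J
  ...     | p<x , x≤m = ≤-<-trans z≤n p<x , m≤n⇒m≤1+n x≤m
  covers′ : ∀ {x} → 0 < x → x ≤ suc m → x ∈ I ++ suc m ∷ J
  covers′ {x} 0<x x≤1+m with x ≤? p | x ≟ suc m
  ... | yes x≤p | _         = ∈-++⁺ˡ (covers PI 0<x x≤p)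
  ... | no  _   | yes refl  = ∈-insert I
  ... | no  x≰p | no  x≢1+m = ∈-++⁺ʳ I (there (covers PJ (≰⇒> x≰p) (s≤s⁻¹ (≤∧≢⇒< x≤1+m x≢1+m))))

isPerm-split⁻ : ∀ {m I J} → IsPerm (suc m) (I ++ suc m ∷ J) → (∀ {x z} → x ∈ I → z ∈ J → x < z) →
  maxL I ≤ m × IsPerm (maxL I) I × IsPermOf (maxL I) m J
isPerm-split⁻ {m} {I} {J} P I<J = p≤m , PI , PJ
  where
  p = maxL I
  1+m∉ : suc m ∉ I ++ J
  1+m∉ = unique-middle⁻ I (unique P)
  ≤m : ∀ {x} → x ∈ I ++ J → x ≤ m
  ≤m x∈ = s≤s⁻¹ (≤∧≢⇒< (proj₂ (bounded P (∈-middle⁺ I x∈))) λ { refl → 1+m∉ x∈ })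
  p≤m : p ≤ m
  p≤m = maxL-lub I (≤m ∘ ∈-++⁺ˡ)
  J⊆ : J ⊆ I ++ suc m ∷ J
  J⊆ = Sublist.++⁺ˡ I (suc m ∷ʳ ⊆-refl)
  p<J : ∀ {z} → z ∈ J → p < z
  p<J z∈J = maxL-< I (proj₁ (bounded P (lookup J⊆ z∈J))) (λ x∈I → I<J x∈I z∈J)
  in-I++J : ∀ {x} → 0 < x → x ≤ m → x ∈ I ++ J
  in-I++J 0<x x≤m with ∈-middle⁻ I (covers P 0<x (m≤n⇒m≤1+n x≤m))
  ... | inj₁ refl = contradiction x≤m 1+n≰n
  ... | inj₂ x∈   = x∈
  PI : IsPerm p I
  PI = record
    { unique  = unique-⊆ (Sublist.++⁺ʳ _ ⊆-refl) (unique P)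
    ; bounded = λ x∈I → proj₁ (bounded P (∈-++⁺ˡ x∈I)) , ∈⇒≤maxL I x∈I
    ; covers  = λ {x} 0<x x≤p → [ id , (λ x∈J → contradiction x≤p (<⇒≱ (p<J x∈J))) ]′
                                  (∈-++⁻ I (in-I++J 0<x (≤-trans x≤p p≤m)))
    }
  PJ : IsPermOf p m J
  PJ = record
    { unique  = unique-⊆ J⊆ (unique P)
    ; bounded = λ z∈J → p<J z∈J , ≤m (∈-++⁺ʳ I z∈J)
    ; covers  = λ p<x x≤m → [ (λ x∈I → contradiction (∈⇒≤maxL I x∈I) (<⇒≱ p<x)) , id ]′
                              (∈-++⁻ I (in-I++J (≤-<-trans z≤n p<x) x≤m))
    }

isPerm-delete : ∀ {m} A {s} B → IsPerm (suc m) (A ++ s ∷ B) → IsPerm m (map (unbumpLetter s) (A ++ B))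
isPerm-delete {m} A {s} B P = record
  { unique  = unique-map⁺ unbump-injective (unique-⊆ (⊆-skip-middle A) (unique P))
  ; bounded = bounded′
  ; covers  = covers′
  }
  where
  s∉ : s ∉ A ++ B
  s∉ = unique-middle⁻ A (unique P)
  ≢s : ∀ {x} → x ∈ A ++ B → x ≢ s
  ≢s x∈ refl = s∉ x∈
  s-bounds : 0 < s × s ≤ suc m
  s-bounds = bounded P (∈-insert A)
  unbump-injective : ∀ {x y} → x ∈ A ++ B → y ∈ A ++ B → unbumpLetter s x ≡ unbumpLetter s y → x ≡ y
  unbump-injective {x} {y} x∈ y∈ eq = begin
    x                                 ≡⟨ bump-unbump (≢s x∈) ⟨
    bumpLetter s (unbumpLetter s x)   ≡⟨ cong (bumpLetter s) eq ⟩
    bumpLetter s (unbumpLetter s y)   ≡⟨ bump-unbump (≢s y∈) ⟩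
    y                                 ∎
    where open ≡-Reasoning
  bounded′ : ∀ {y} → y ∈ map (unbumpLetter s) (A ++ B) → 0 < y × y ≤ m
  bounded′ y∈ with ∈-map⁻ (unbumpLetter s) y∈
  ... | x , x∈ , refl = unbumpLetter-bounds s-bounds (bounded P (∈-middle⁺ A x∈)) (≢s x∈)
  covers′ : ∀ {y} → 0 < y → y ≤ m → y ∈ map (unbumpLetter s) (A ++ B)
  covers′ {y} 0<y y≤m
    with ∈-middle⁻ A (covers P (≤-trans 0<y (≤-bumpLetter s y)) (≤-trans (bumpLetter-≤ s y) (s≤s y≤m)))
  ... | inj₁ by≡s = contradiction by≡s (bumpLetter-≢ s y)
  ... | inj₂ by∈  = subst (_∈ _) (unbump-bump s y) (∈-map⁺ (unbumpLetter s) by∈)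

isPerm-insertLetter : ∀ {n a} A B → 0 < a → a ≤ suc n → IsPerm n (A ++ B) →
  IsPerm (suc n) (insertLetter a A B)
isPerm-insertLetter {n} {a} A B 0<a a≤1+n P = record
  { unique  = unique-middle⁺ (bump a A) a∉
                (subst Unique bump-++ (unique-map⁺ (λ _ _ → bumpLetter-injective a) (unique P)))
  ; bounded = bounded′
  ; covers  = covers′
  }
  where
  bump-++ : bump a (A ++ B) ≡ bump a A ++ bump a B
  bump-++ = map-++ (bumpLetter a) A B
  from-bumped : ∀ {y} → y ∈ bump a A ++ bump a B → ∃ λ x → x ∈ A ++ B × y ≡ bumpLetter a x
  from-bumped y∈ = ∈-map⁻ (bumpLetter a) (subst (_ ∈_) (sym bump-++) y∈)
  a∉ : a ∉ bump a A ++ bump a B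
  a∉ a∈ with from-bumped a∈
  ... | x , _ , a≡bx = bumpLetter-≢ a x (sym a≡bx)
  bounded′ : ∀ {y} → y ∈ insertLetter a A B → 0 < y × y ≤ suc n
  bounded′ y∈ with ∈-middle⁻ (bump a A) y∈
  ... | inj₁ refl = 0<a , a≤1+n
  ... | inj₂ y∈′ with from-bumped y∈′
  ...   | x , x∈ , refl with bounded P x∈
  ...     | 0<x , x≤n = ≤-trans 0<x (≤-bumpLetter a x) , ≤-trans (bumpLetter-≤ a x) (s≤s x≤n)
  covers′ : ∀ {y} → 0 < y → y ≤ suc n → y ∈ insertLetter a A B
  covers′ {y} 0<y y≤1+n with y ≟ a
  ... | yes refl = ∈-insert (bump a A)
  ... | no  y≢a  = ∈-middle⁺ (bump a A) (subst (y ∈_) bump-++ y∈)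
    where
    x∈ : unbumpLetter a y ∈ A ++ B
    x∈ = uncurry (covers P) (unbumpLetter-bounds (0<a , a≤1+n) (0<y , y≤1+n) y≢a)
    y∈ : y ∈ bump a (A ++ B)
    y∈ = subst (_∈ bump a (A ++ B)) (bump-unbump y≢a) (∈-map⁺ (bumpLetter a) x∈)

-- One-stack sortable permutations are the 231-avoiding ones

avoids231-split⁺ : ∀ {m I J} → (∀ {x} → x ∈ I ++ J → x ≤ m) → (∀ {x z} → x ∈ I → z ∈ J → x < z) →
  Avoids231 I → Avoids231 J → Avoids231 (I ++ suc m ∷ J)
avoids231-split⁺ {m} {I} {J} ≤m I<J avI avJ =
  subst Avoids231
    (cong₂ (λ I′ J′ → I′ ++ suc m ∷ J′) (bump-id (<1+m ∘ ∈-++⁺ˡ)) (bump-id (<1+m ∘ ∈-++⁺ʳ I)))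
    (avoids231-insertLetter I J (avoids231-++ avI avJ I<J) safe)
  where
  <1+m : ∀ {x} → x ∈ I ++ J → x < suc m
  <1+m = s≤s ∘ ≤m
  safe : SafeInsertion (suc m) I J
  safe = record
    { not-first  = λ yz⊆J _ 1+m≤y → 1+n≰n (≤-trans 1+m≤y (≤m (∈-++⁺ʳ I (to∈ yz⊆J))))
    ; not-middle = λ x∈I z∈J z<x _ → <-asym z<x (I<J x∈I z∈J)
    ; not-last   = λ xy⊆I 1+m≤x _ → 1+n≰n (≤-trans 1+m≤x (≤m (∈-++⁺ˡ (to∈ xy⊆I))))
    }

avoids231-split⁻ : ∀ {m I J} → IsPerm (suc m) (I ++ suc m ∷ J) → Avoids231 (I ++ suc m ∷ J) →
  ∀ {x z} → x ∈ I → z ∈ J → x < z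
avoids231-split⁻ {m} {I} {J} P av {x} {z} x∈I z∈J with x <? z
... | yes x<z = x<z
... | no  x≮z = ⊥-elim (av x-top-z z<x x<1+m)
  where
  x-top-z : x ∷ suc m ∷ z ∷ [] ⊆ I ++ suc m ∷ J
  x-top-z = Sublist.++⁺ (from∈ x∈I) (refl ∷ from∈ z∈J)
  z<x : z < x
  z<x = ≤∧≢⇒< (≮⇒≥ x≮z) λ { refl → unique-++-disjoint I (unique P) x∈I (there z∈J) }
  x<1+m : x < suc m
  x<1+m = ≤∧≢⇒< (proj₂ (bounded P (∈-++⁺ˡ x∈I))) λ { refl → unique-middle⁻ I (unique P) (∈-++⁺ˡ x∈I) }

oss⇒isPerm : ∀ {n w} → OSS n w → IsPerm n w
oss⇒isPerm oss-empty = isPerm-[]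
oss⇒isPerm (oss-split p≤m ossI J-bounds ossJ) =
  isPerm-split⁺ p≤m (oss⇒isPerm ossI) (isPermOf-∸⁻ J-bounds (oss⇒isPerm ossJ))

oss⇒avoids231 : ∀ {n w} → OSS n w → Avoids231 w
oss⇒avoids231 oss-empty ()
oss⇒avoids231 (oss-split {m} {p} {I} {J} p≤m ossI J-bounds ossJ) =
  avoids231-split⁺ ≤m I<J (oss⇒avoids231 ossI)
    (subst Avoids231 unshift (avoids231-map (+-monoˡ-≤ p) (oss⇒avoids231 ossJ)))
  where
  I≤p : ∀ {x} → x ∈ I → x ≤ p
  I≤p = proj₂ ∘ bounded (oss⇒isPerm ossI)
  ≤m : ∀ {x} → x ∈ I ++ J → x ≤ m
  ≤m x∈ = [ (λ x∈I → ≤-trans (I≤p x∈I) p≤m) , proj₂ ∘ All.lookup J-bounds ]′ (∈-++⁻ I x∈)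
  I<J : ∀ {x z} → x ∈ I → z ∈ J → x < z
  I<J x∈I z∈J = ≤-<-trans (I≤p x∈I) (proj₁ (All.lookup J-bounds z∈J))
  unshift : map (_+ p) (map (_∸ p) J) ≡ J
  unshift = trans (sym (map-∘ J)) (map-id-local (All.map (m∸n+n≡m ∘ <⇒≤ ∘ proj₁) J-bounds))

isPerm∧avoids231⇒oss : ∀ n {w} → IsPerm n w → Avoids231 w → OSS n w
isPerm∧avoids231⇒oss = <-rec _ step
  where
  step : ∀ n → (∀ {k} → k < n → ∀ {w} → IsPerm k w → Avoids231 w → OSS k w) →
         ∀ {w} → IsPerm n w → Avoids231 w → OSS n w
  step zero    _   {[]}    _ _ = oss-empty
  step zero    _   {x ∷ _} P _ = contradiction (bounded P (here refl)) λ (0<x , x≤0) → <⇒≱ 0<x x≤0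
  step (suc m) rec P av with ∈-∃++ (covers P (s≤s z≤n) ≤-refl)
  ... | I , J , refl with isPerm-split⁻ P (avoids231-split⁻ P av)
  ...   | p≤m , PI , PJ = oss-split p≤m
      (rec (s≤s p≤m) PI (avoids231-⊆ (Sublist.++⁺ʳ _ ⊆-refl) av))
      (All.tabulate (bounded PJ))
      (rec (s≤s (m∸n≤m m (maxL I))) (isPermOf-∸ p≤m PJ)
        (avoids231-map (∸-monoˡ-≤ (maxL I)) (avoids231-⊆ (Sublist.++⁺ˡ I (suc m ∷ʳ ⊆-refl)) av)))

-- Deletion and insertion

oss-deleteLetter : ∀ {m} A {s} B → OSS (suc m) (A ++ s ∷ B) → OSS m (map (unbumpLetter s) (A ++ B))
oss-deleteLetter {m} A {s} B oss =
  isPerm∧avoids231⇒oss m (isPerm-delete A B (oss⇒isPerm oss))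
    (avoids231-map (unbumpLetter-mono s) (avoids231-⊆ (⊆-skip-middle A) (oss⇒avoids231 oss)))

removeAt-split : ∀ (σ : List ℕ) k → ∃₂ λ A B → σ ≡ A ++ List.lookup σ k ∷ B × removeAt σ k ≡ A ++ B
removeAt-split (x ∷ σ) zero    = [] , σ , refl , refl
removeAt-split (x ∷ σ) (suc k) with removeAt-split σ k
... | A , B , σ≡ , removed≡ = x ∷ A , B , cong (x ∷_) σ≡ , cong (x ∷_) removed≡

oneStackSortable-delete : ∀ {σ} → OneStackSortable σ → (k : Fin (length σ)) →
  OneStackSortable (delete σ k)
oneStackSortable-delete (_ , oss-empty) ()
oneStackSortable-delete {σ} (suc m , oss) k with removeAt-split σ k
... | A , B , σ≡ , removed≡ =
  m , subst (OSS m ∘ map (unbumpLetter (List.lookup σ k))) (sym removed≡)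
            (oss-deleteLetter A B (subst (OSS (suc m)) σ≡ oss))

oss-insertLetter : ∀ {n a} A B → 0 < a → a ≤ suc n → OSS n (A ++ B) → SafeInsertion a A B →
  OneStackSortable (insertLetter a A B)
oss-insertLetter {n} A B 0<a a≤1+n oss safe =
  suc n , isPerm∧avoids231⇒oss (suc n) (isPerm-insertLetter A B 0<a a≤1+n (oss⇒isPerm oss))
                                       (avoids231-insertLetter A B (oss⇒avoids231 oss) safe)

module CompleteFactor {n u f v} (oss : OSS n (u ++ f ++ v)) (complete : Complete (u ++ f ++ v) f) where

  private
    P  = oss⇒isPerm oss
    av = oss⇒avoids231 oss
    c  = minL f
    d  = maxL f

  c∈f : c ∈ f
  c∈f = minL-∈ f (proj₁ complete)

  d∈f : d ∈ f
  d∈f = maxL-∈ f (proj₁ complete)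

  c≤d : c ≤ d
  c≤d = minL-≤ f d∈f

  ∈f⇒c≤ : ∀ {x} → x ∈ f → c ≤ x
  ∈f⇒c≤ = minL-≤ f

  ∈f⇒≤d : ∀ {x} → x ∈ f → x ≤ d
  ∈f⇒≤d = ∈⇒≤maxL f

  c-bounds : 0 < c × c ≤ n
  c-bounds = bounded P (∈-++⁺ʳ u (∈-++⁺ˡ c∈f))

  d≤n : d ≤ n
  d≤n = proj₂ (bounded P (∈-++⁺ʳ u (∈-++⁺ˡ d∈f)))

  fill : ∀ {x} → c ≤ x → x ≤ d → x ∈ f
  fill c≤x x≤d with proj₁ (proj₂ (proj₂ complete))
  ... | a , b , f⊆[a,b] , [a,b]⊆f =
    [a,b]⊆f _ (≤-trans (proj₁ (f⊆[a,b] c c∈f)) c≤x) (≤-trans x≤d (proj₂ (f⊆[a,b] d d∈f)))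

  ∉f-below : ∀ {x} → x ∉ f → x ≤ d → x < c
  ∉f-below {x} x∉f x≤d with c ≤? x
  ... | yes c≤x = contradiction (fill c≤x x≤d) x∉f
  ... | no  c≰x = ≰⇒> c≰x

  ∉f-above : ∀ {x} → x ∉ f → c ≤ x → d < x
  ∉f-above {x} x∉f c≤x with x ≤? d
  ... | yes x≤d = contradiction (fill c≤x x≤d) x∉f
  ... | no  x≰d = ≰⇒> x≰d

  ∈u⇒∉f : ∀ {x} → x ∈ u → x ∉ f
  ∈u⇒∉f x∈u x∈f = unique-++-disjoint u (unique P) x∈u (∈-++⁺ˡ x∈f)

  ∈u⇒∉v : ∀ {x} → x ∈ u → x ∉ v
  ∈u⇒∉v x∈u x∈v = unique-++-disjoint u (unique P) x∈u (∈-++⁺ʳ f x∈v)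

  ∈v⇒∉f : ∀ {x} → x ∈ v → x ∉ f
  ∈v⇒∉f x∈v x∈f = unique-++-disjoint f (unique-⊆ (Sublist.++⁺ˡ u ⊆-refl) (unique P)) x∈f x∈v

  no-ascent-in-u : ∀ {x y} → x ∷ y ∷ [] ⊆ u → c ≤ x → x < y → ⊥
  no-ascent-in-u xy⊆u c≤x x<y =
    av (Sublist.++⁺ xy⊆u (Sublist.++⁺ʳ v (from∈ d∈f))) (∉f-above (∈u⇒∉f (to∈ xy⊆u)) c≤x) x<y

  rest-above : ∀ {x} → x ∈ dropWhile (_<? c) v → d < x
  rest-above with dropWhile (_<? c) v | All.all-head-dropWhile (_<? c) v | Sublist.dropWhile-⊆ (_<? c) v
  ... | []    | _        | _    = λ ()
  ... | y ∷ r | just y≮c | yr⊆v = above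
    where
    d<y : d < y
    d<y = ∉f-above (∈v⇒∉f (to∈ yr⊆v)) (≮⇒≥ y≮c)
    above : ∀ {x} → x ∈ y ∷ r → d < x
    above (here refl) = d<y
    above {x} (there x∈r) with x <? c
    ... | yes x<c = ⊥-elim (av (Sublist.++⁺ˡ u (Sublist.++⁺ (from∈ d∈f) (⊆-trans (refl ∷ from∈ x∈r) yr⊆v)))
                               (<-≤-trans x<c c≤d) d<y)
    ... | no  x≮c = ∉f-above (∈v⇒∉f (lookup yr⊆v (there x∈r))) (≮⇒≥ x≮c)

  compact-extension : ∀ {g r} → v ≡ g ++ r → g ≢ [] → All (_< c) g → (∀ {x} → x ∈ r → d < x) →
    Compact (f ++ g)
  compact-extension {g} {r} v≡ g≢[] g<c r>d = e , d , bounded′ , fill′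
    where
    e = minL g
    e∈v : e ∈ v
    e∈v = subst (e ∈_) (sym v≡) (∈-++⁺ˡ (minL-∈ g g≢[]))
    e<c : e < c
    e<c = All.lookup g<c (minL-∈ g g≢[])
    bounded′ : ∀ x → x ∈ f ++ g → e ≤ x × x ≤ d
    bounded′ x x∈ = [ (λ x∈f → <⇒≤ (<-≤-trans e<c (∈f⇒c≤ x∈f)) , ∈f⇒≤d x∈f)
                    , (λ x∈g → minL-≤ g x∈g , <⇒≤ (<-≤-trans (All.lookup g<c x∈g) c≤d)) ]′ (∈-++⁻ f x∈)
    below-c : ∀ {x} → x ∈ u ++ f ++ v → e ≤ x → x < c → x ∈ g
    below-c {x} x∈ e≤x x<c with ∈-++⁻ u x∈
    ... | inj₁ x∈u = ⊥-elim (av (Sublist.++⁺ (from∈ x∈u) (Sublist.++⁺ (from∈ d∈f) (from∈ e∈v)))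
                                (≤∧≢⇒< e≤x λ { refl → ∈u⇒∉v x∈u e∈v }) (<-≤-trans x<c c≤d))
    ... | inj₂ x∈f++v with ∈-++⁻ f x∈f++v
    ...   | inj₁ x∈f = contradiction (∈f⇒c≤ x∈f) (<⇒≱ x<c)
    ...   | inj₂ x∈v = [ id , (λ x∈r → contradiction (<-≤-trans x<c c≤d) (<-asym (r>d x∈r))) ]′
                         (∈-++⁻ g (subst (x ∈_) v≡ x∈v))
    fill′ : ∀ x → e ≤ x → x ≤ d → x ∈ f ++ g
    fill′ x e≤x x≤d with c ≤? x
    ... | yes c≤x = ∈-++⁺ˡ (fill c≤x x≤d)
    ... | no  c≰x = ∈-++⁺ʳ f (below-c (covers P 0<x (≤-trans x≤d d≤n)) e≤x (≰⇒> c≰x))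
      where
      0<x : 0 < x
      0<x = <-≤-trans (proj₁ (bounded P (∈-++⁺ʳ u (∈-++⁺ʳ f e∈v)))) e≤x

  prefix-below-empty : ∀ g r → v ≡ g ++ r → All (_< c) g → (∀ {x} → x ∈ r → d < x) → g ≡ []
  prefix-below-empty []        _ _  _   _   = refl
  prefix-below-empty g@(_ ∷ _) r v≡ g<c r>d =
    ⊥-elim (proj₂ (proj₂ (proj₂ complete))
             (g , (λ ()) , (u , r , factor) , compact-extension v≡ (λ ()) g<c r>d , max≡d))
    where
    factor : u ++ f ++ v ≡ u ++ (f ++ g) ++ r
    factor = trans (cong (λ w → u ++ f ++ w) v≡) (cong (u ++_) (sym (++-assoc f g r)))
    ≤d : ∀ {x} → x ∈ f ++ g → x ≤ d
    ≤d x∈ = [ ∈f⇒≤d , (λ x∈g → <⇒≤ (<-≤-trans (All.lookup g<c x∈g) c≤d)) ]′ (∈-++⁻ f x∈)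
    max≡d : maxL (f ++ g) ≡ d
    max≡d = ≤-antisym (maxL-lub (f ++ g) ≤d) (∈⇒≤maxL (f ++ g) (∈-++⁺ˡ d∈f))

  v-above : ∀ {z} → z ∈ v → d < z
  v-above {z} = rest-above ∘ subst (z ∈_) v≡rest
    where
    v≡ : v ≡ takeWhile (_<? c) v ++ dropWhile (_<? c) v
    v≡ = sym (takeWhile++dropWhile (_<? c) v)
    v≡rest : v ≡ dropWhile (_<? c) v
    v≡rest = trans v≡ (cong (_++ dropWhile (_<? c) v)
                            (prefix-below-empty _ _ v≡ (All.all-takeWhile (_<? c) v) rest-above))

  f++v-above : ∀ {z} → z ∈ f ++ v → c ≤ z
  f++v-above z∈ = [ ∈f⇒c≤ , (λ z∈v → <⇒≤ (≤-<-trans c≤d (v-above z∈v))) ]′ (∈-++⁻ f z∈)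

  f<1+d : ∀ {x} → x ∈ f → x < suc d
  f<1+d = s≤s ∘ ∈f⇒≤d

  insert-before : OneStackSortable (insΛ→f u f v)
  insert-before = subst OneStackSortable (cong (λ w → bump (suc d) u ++ suc d ∷ w) bump-f++v)
    (oss-insertLetter u (f ++ v) (s≤s z≤n) (s≤s d≤n) oss record
      { not-first  = λ yz⊆f++v z<1+d 1+d≤y →
                       [ (λ yz⊆f → 1+n≰n (≤-trans 1+d≤y (∈f⇒≤d (to∈ yz⊆f))))
                       , (λ z∈v → <⇒≱ (v-above z∈v) (s≤s⁻¹ z<1+d)) ]′ (pair-⊆-++⁻ f yz⊆f++v)
      ; not-middle = λ x∈u z∈f++v z<x x<1+d →
                       <⇒≱ (<-trans z<x (∉f-below (∈u⇒∉f x∈u) (s≤s⁻¹ x<1+d))) (f++v-above z∈f++v)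
      ; not-last   = λ xy⊆u 1+d≤x → no-ascent-in-u xy⊆u (≤-trans c≤d (<⇒≤ 1+d≤x))
      })
    where
    bump-f++v : bump (suc d) (f ++ v) ≡ f ++ bump (suc d) v
    bump-f++v = trans (map-++ (bumpLetter (suc d)) f v) (cong (_++ bump (suc d) v) (bump-id f<1+d))

  insert-after : OneStackSortable (insΛ→ʳf u f v)
  insert-after = subst OneStackSortable equation
    (oss-insertLetter (u ++ f) v (s≤s z≤n) (s≤s d≤n) (subst (OSS n) (sym (++-assoc u f v)) oss) record
      { not-first  = λ yz⊆v z<1+d _ → <⇒≱ (v-above (lookup yz⊆v (there (here refl)))) (s≤s⁻¹ z<1+d)
      ; not-middle = λ _ z∈v z<x x<1+d → <⇒≱ (v-above z∈v) (<⇒≤ (<-≤-trans z<x (s≤s⁻¹ x<1+d)))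
      ; not-last   = λ xy⊆u++f 1+d≤x x<y →
                       [ (λ xy⊆u → no-ascent-in-u xy⊆u (≤-trans c≤d (<⇒≤ 1+d≤x)) x<y)
                       , (λ y∈f → <⇒≱ (<-trans 1+d≤x x<y) (∈f⇒≤d y∈f)) ]′ (pair-⊆-++⁻ u xy⊆u++f)
      })
    where
    equation : insertLetter (suc d) (u ++ f) v ≡ insΛ→ʳf u f v
    equation = begin
      bump (suc d) (u ++ f) ++ suc d ∷ bump (suc d) v
        ≡⟨ cong (_++ suc d ∷ bump (suc d) v) (map-++ (bumpLetter (suc d)) u f) ⟩
      (bump (suc d) u ++ bump (suc d) f) ++ suc d ∷ bump (suc d) v
        ≡⟨ cong (λ w → (bump (suc d) u ++ w) ++ suc d ∷ bump (suc d) v) (bump-id f<1+d) ⟩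
      (bump (suc d) u ++ f) ++ suc d ∷ bump (suc d) v
        ≡⟨ ++-assoc (bump (suc d) u) f _ ⟩
      bump (suc d) u ++ f ++ suc d ∷ bump (suc d) v
        ∎
      where open ≡-Reasoning

  insert-below : OneStackSortable (insΛ→ˡf u f v)
  insert-below = subst OneStackSortable (cong (λ w → bump c u ++ c ∷ w) (map-++ (bumpLetter c) f v))
    (oss-insertLetter u (f ++ v) (proj₁ c-bounds) (m≤n⇒m≤1+n (proj₂ c-bounds)) oss record
      { not-first  = λ yz⊆f++v z<c _ → <⇒≱ z<c (f++v-above (lookup yz⊆f++v (there (here refl))))
      ; not-middle = λ _ z∈f++v z<x x<c → <⇒≱ (<-trans z<x x<c) (f++v-above z∈f++v)
      ; not-last   = no-ascent-in-u
      })

mainTheorem2 : (σ : List ℕ) → OneStackSortable σ →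
    ((k : Fin (length σ)) → OneStackSortable (delete σ k)) ×
    (σ ≡ [] → OneStackSortable (1 ∷ [])) ×
    ((u f v : List ℕ) → σ ≡ u ++ f ++ v → Complete σ f →
      OneStackSortable (insΛ→f u f v) × OneStackSortable (insΛ→ʳf u f v) × OneStackSortable (insΛ→ˡf u f v))
mainTheorem2 σ (n , oss) =
  oneStackSortable-delete (n , oss) ,
  (λ _ → 1 , oss-split z≤n oss-empty All.[] oss-empty) ,
  λ { u f v refl complete → let open CompleteFactor {u = u} {f} {v} oss complete
                            in insert-before , insert-after , insert-below }
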